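{- Let $G=(V,E)$ be a simple, strongly connected and balanced directed graph on $V=\{1,\dots,n\}$ with $n\ge 2$, with Laplacian $L$ and resistance matrix $R=[r_{ij}]$. Let $X=(L+\frac1n J)^{ -1}$, $\tilde X=\operatorname{diag}(X)$, $\tilde x=\tilde X\mathbf{1}$ (the vector of diagonal entries of $X$), $M=L-L'$, and let $\tau\in\mathbb{R}^n$ have entries $\tau_i=2-\sum_{\{j:(i,j)\in E\}} r_{ji}$. Then: (i) $\tau=L\tilde X\mathbf{1}+\frac2n\mathbf{1}$; (ii) $\tau'+\mathbf{1}'\tilde XM=\mathbf{1}'\tilde XL+\frac2n\mathbf{1}'$; (iii) $LR+2I=\tau\mathbf{1}'$; (iv) $RL+2I=\mathbf{1}\tau'+J\tilde XM$; (v) $\mathbf{1}'\tau=2$; (vi) $\tau'R\tau=2\tilde x'L\tilde x+\frac8n\operatorname{trace}(L^\dagger)$; (vii) $\tau'R\tau>0$.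
   Context: For a simple directed graph $G=(V,E)$, the adjacency matrix is $A=[a_{ij}]$ with $a_{ij}=1$ if $(i,j)\in E$ and $0$ otherwise. $G$ is balanced if every vertex has indegree (column sum of $A$) equal to outdegree (row sum of $A$); strongly connected if every ordered pair of vertices is joined by a directed path. The Laplacian is $L=\operatorname{Diag}(A\mathbf{1})-A$. With $L^\dagger=[l^\dagger_{ij}]$ the Moore–Penrose inverse, $r_{ij}=l^\dagger_{ii}+l^\dagger_{jj}-2l^\dagger_{ij}$ and $R=[r_{ij}]$. Notation: $\mathbf{1}$ is the all-ones vector in $\mathbb{R}^n$, $J=\mathbf{1}\mathbf{1}'$, $I$ the identity, $'$ transpose, and for a square matrix $Y$, $\operatorname{diag}(Y)$ is the diagonal matrix with the same diagonal entries as $Y$. (The matrix $L+\frac1nJ$ is invertible in this setting.)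
   Formalization: The scalars, including the entries of the Moore–Penrose inverse $L^\dagger$ and of $X$, are rational instead of real. -}

module Defs where

open import Data.Nat as ℕ using (ℕ; zero; suc)
open import Data.Fin using (Fin; zero; suc; _≟_)
open import Data.Bool using (Bool; true; false; if_then_else_)
open import Data.Integer using (+_)
open import Data.Rational using (ℚ; 0ℚ; 1ℚ; _+_; _*_; _-_; _/_)
open import Relation.Nullary using (does)
open import Relation.Binary.PropositionalEquality using (_≡_)

ℕtoℚ : ℕ → ℚ
ℕtoℚ n = + n / 1

-- 1/n as a rational (only used for n ≥ 2; value at 0 is irrelevant)
inv : ℕ → ℚ
inv zero = 0ℚ
inv (suc k) = + 1 / suc k

sumF : ∀ {n} → (Fin n → ℚ) → ℚ
sumF {zero} f = 0ℚ
sumF {suc n} f = f zero + sumF (λ i → f (suc i))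

Vector : ℕ → Set
Vector n = Fin n → ℚ

Matrix : ℕ → Set
Matrix n = Fin n → Fin n → ℚ

𝟏 : ∀ {n} → Vector n
𝟏 _ = 1ℚ

Id : ∀ {n} → Matrix n
Id i j = if does (i ≟ j) then 1ℚ else 0ℚ

Jm : ∀ {n} → Matrix n
Jm _ _ = 1ℚ

_⊗_ : ∀ {n} → Matrix n → Matrix n → Matrix n
(A ⊗ B) i j = sumF (λ k → A i k * B k j)
infixl 7 _⊗_

_⊕_ : ∀ {n} → Matrix n → Matrix n → Matrix n
(A ⊕ B) i j = A i j + B i j
infixl 6 _⊕_

_⊖_ : ∀ {n} → Matrix n → Matrix n → Matrix n
(A ⊖ B) i j = A i j - B i j
infixl 6 _⊖_

scale : ∀ {n} → ℚ → Matrix n → Matrix n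
scale c A i j = c * A i j

transpose : ∀ {n} → Matrix n → Matrix n
transpose A i j = A j i

diagM : ∀ {n} → Matrix n → Matrix n
diagM Y i j = if does (i ≟ j) then Y i i else 0ℚ

Diag : ∀ {n} → Vector n → Matrix n
Diag v i j = if does (i ≟ j) then v i else 0ℚ

mv : ∀ {n} → Matrix n → Vector n → Vector n
mv A v i = sumF (λ k → A i k * v k)

vm : ∀ {n} → Vector n → Matrix n → Vector n
vm v A j = sumF (λ k → v k * A k j)

quad : ∀ {n} → Vector n → Matrix n → ℚ
quad v A = sumF (λ i → sumF (λ j → v i * A i j * v j))

trace : ∀ {n} → Matrix n → ℚ
trace A = sumF (λ i → A i i)

_≐_ : ∀ {n} → Matrix n → Matrix n → Set
A ≐ B = ∀ i j → A i j ≡ B i j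

Digraph : ℕ → Set
Digraph n = Fin n → Fin n → Bool

adj : ∀ {n} → Digraph n → Matrix n
adj E i j = if E i j then 1ℚ else 0ℚ

-- simple: no loops (multiple edges are impossible in this encoding)
Simple : ∀ {n} → Digraph n → Set
Simple E = ∀ i → E i i ≡ false

Balanced : ∀ {n} → Digraph n → Set
Balanced {n} E = ∀ i → sumF (λ k → adj E k i) ≡ sumF (λ k → adj E i k)

data Path {n} (E : Digraph n) : Fin n → Fin n → Set where
  here : ∀ {i} → Path E i i
  step : ∀ {i j k} → E i j ≡ true → Path E j k → Path E i k

StronglyConnected : ∀ {n} → Digraph n → Set
StronglyConnected E = ∀ i j → Path E i j

Laplacian : ∀ {n} → Digraph n → Matrix n
Laplacian E = Diag (mv (adj E) 𝟏) ⊖ adj E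

IsMoorePenrose : ∀ {n} → Matrix n → Matrix n → Set
IsMoorePenrose A P =
  ((A ⊗ P ⊗ A) ≐ A) ×' ((P ⊗ A ⊗ P) ≐ P) ×'
  (transpose (A ⊗ P) ≐ (A ⊗ P)) ×' (transpose (P ⊗ A) ≐ (P ⊗ A))
  where open import Data.Product renaming (_×_ to _×'_)

IsInverse : ∀ {n} → Matrix n → Matrix n → Set
IsInverse A X = ((A ⊗ X) ≐ Id) ×' ((X ⊗ A) ≐ Id)
  where open import Data.Product renaming (_×_ to _×'_)

resistance : ∀ {n} → Matrix n → Matrix n
resistance P i j = P i i + P j j - ℕtoℚ 2 * P i j

tauVec : ∀ {n} → Digraph n → Matrix n → Vector n
tauVec E R i = ℕtoℚ 2 - sumF (λ j → if E i j then R j i else 0ℚ)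

-- Everything rests on L† = (L + J/n)⁻¹ − J/n. A balanced Laplacian has zero row and column sums,
-- so X = (L + J/n)⁻¹ satisfies L X = X L = I − J/n, and the Penrose equations then force L† = X − J/n;
-- in particular L L† = L† L = I − J/n and L† has zero row and column sums. With d the diagonal of L†,
-- R = d𝟏ᵀ + 𝟏dᵀ − 2L†, hence L R = (L d)𝟏ᵀ − 2(I − J/n) and R L = 𝟏(dᵀL) − 2(I − J/n). The diagonal of
-- L R identifies τ = L d + (2/n)𝟏, and since X̃𝟏 = d + 𝟏/n is d shifted by a constant, which L does
-- not see, all the identities follow by rearranging. For positivity, xᵀLx = ½ Σ aᵢⱼ (xᵢ − xⱼ)² ≥ 0 on
-- a balanced graph, and each l†ᵢᵢ is such a form evaluated at a column of L†.

module Submission where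

open import Defs
open import Algebra.Bundles using (CommutativeRing)
open import Data.Bool using (true; false; if_then_else_)
open import Data.Empty using (⊥-elim)
open import Data.Sum using (inj₁; inj₂)
open import Data.Fin using (Fin; zero; suc; _≟_; punchIn)
open import Data.Fin.Properties using (punchInᵢ≢i)
open import Data.Integer using () renaming (+_ to pos)
import Data.Integer as ℤ
import Data.Integer.Properties as ℤP
open import Data.Nat using (ℕ; zero; suc; NonZero; _≤_; s≤s)
open import Data.Product using (_×_; _,_; proj₁; proj₂)
open import Data.Rational as ℚ using (ℚ; 0ℚ; 1ℚ; _+_; _*_; _-_; -_; _<_; mkℚ; ↥_; 1/_; nonNegative; nonPositive; positive; negative)
open import Data.Rational.Properties hiding (_≟_)
open import Data.Rational.Solver using (module +-*-Solver)
open import Data.Nat.Coprimality using (1-coprimeTo) renaming (sym to coprime-sym)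
open import Function using (_∘_)
open import Relation.Binary.Definitions using (tri<; tri≈; tri>)
open import Relation.Binary.PropositionalEquality
open import Relation.Nullary.Decidable using (dec-true; dec-false)
open import Algebra.Properties.Ring +-*-ring using (x[y-z]≈xy-xz; [y-z]x≈yx-zx; -1*x≈-x)
open import Algebra.Properties.Semiring.Sum (CommutativeRing.semiring +-*-commutativeRing)
  using (sum; sum-cong-≗; sum-replicate-zero; sum-remove; ∑-distrib-+; ∑-comm; *-distribˡ-sum; *-distribʳ-sum)
open +-*-Solver
open ≡-Reasoning

sumF≡sum : ∀ {n} (f : Vector n) → sumF f ≡ sum f
sumF≡sum {zero}  f = refl
sumF≡sum {suc n} f = cong (f zero +_) (sumF≡sum (f ∘ suc))

sumF-cong : ∀ {n} {f g : Vector n} → (∀ i → f i ≡ g i) → sumF f ≡ sumF g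
sumF-cong {f = f} {g} f≗g = trans (sumF≡sum f) (trans (sum-cong-≗ f≗g) (sym (sumF≡sum g)))

sumF-zero : ∀ {n} {f : Vector n} → (∀ i → f i ≡ 0ℚ) → sumF f ≡ 0ℚ
sumF-zero {n} f≗0 = trans (sumF-cong f≗0) (trans (sumF≡sum {n} (λ _ → 0ℚ)) (sum-replicate-zero n))

sumF-+ : ∀ {n} (f g : Vector n) → sumF (λ i → f i + g i) ≡ sumF f + sumF g
sumF-+ f g = begin
  sumF (λ i → f i + g i) ≡⟨ sumF≡sum (λ i → f i + g i) ⟩
  sum (λ i → f i + g i)  ≡⟨ ∑-distrib-+ f g ⟩
  sum f + sum g          ≡⟨ cong₂ _+_ (sumF≡sum f) (sumF≡sum g) ⟨
  sumF f + sumF g        ∎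

sumF-*ˡ : ∀ {n} a (f : Vector n) → sumF (λ i → a * f i) ≡ a * sumF f
sumF-*ˡ a f = trans (sumF≡sum (λ i → a * f i)) (sym (trans (cong (a *_) (sumF≡sum f)) (*-distribˡ-sum a f)))

sumF-*ʳ : ∀ {n} a (f : Vector n) → sumF (λ i → f i * a) ≡ sumF f * a
sumF-*ʳ a f = trans (sumF≡sum (λ i → f i * a)) (sym (trans (cong (_* a) (sumF≡sum f)) (*-distribʳ-sum a f)))

sumF-neg : ∀ {n} (f : Vector n) → sumF (λ i → - f i) ≡ - sumF f
sumF-neg f = begin
  sumF (λ i → - f i)         ≡⟨ sumF-cong (λ i → -1*x≈-x (f i)) ⟨
  sumF (λ i → - 1ℚ * f i)    ≡⟨ sumF-*ˡ (- 1ℚ) f ⟩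
  - 1ℚ * sumF f              ≡⟨ -1*x≈-x (sumF f) ⟩
  - sumF f                   ∎

sumF-- : ∀ {n} (f g : Vector n) → sumF (λ i → f i - g i) ≡ sumF f - sumF g
sumF-- f g = trans (sumF-+ f (λ i → - g i)) (cong (sumF f +_) (sumF-neg g))

sumF-comm : ∀ {m n} (f : Fin m → Fin n → ℚ) →
            sumF (λ i → sumF (f i)) ≡ sumF (λ j → sumF (λ i → f i j))
sumF-comm f = trans (sumF²≡sum² f) (trans (∑-comm f) (sym (sumF²≡sum² (λ j i → f i j))))
  where
  sumF²≡sum² : ∀ {m n} (g : Fin m → Fin n → ℚ) → sumF (λ i → sumF (g i)) ≡ sum (λ i → sum (g i))
  sumF²≡sum² g = trans (sumF-cong (λ i → sumF≡sum (g i))) (sumF≡sum (λ i → sum (g i)))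

sumF-single : ∀ {n} (f : Vector n) j → (∀ k → k ≢ j → f k ≡ 0ℚ) → sumF f ≡ f j
sumF-single {suc n} f j off = begin
  sumF f                      ≡⟨ sumF≡sum f ⟩
  sum f                       ≡⟨ sum-remove {i = j} f ⟩
  f j + sum (f ∘ punchIn j)   ≡⟨ cong (f j +_) (trans (sum-cong-≗ (λ k → off _ (punchInᵢ≢i j k))) (sum-replicate-zero n)) ⟩
  f j + 0ℚ                    ≡⟨ +-identityʳ (f j) ⟩
  f j                         ∎

sumF-nonneg : ∀ {n} {f : Vector n} → (∀ i → 0ℚ ℚ.≤ f i) → 0ℚ ℚ.≤ sumF f
sumF-nonneg {zero}  _   = ≤-refl
sumF-nonneg {suc n} f≥0 = +-mono-≤ (f≥0 zero) (sumF-nonneg (f≥0 ∘ suc))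

term≤sumF : ∀ {n} {f : Vector n} → (∀ i → 0ℚ ℚ.≤ f i) → ∀ i → f i ℚ.≤ sumF f
term≤sumF {suc n} {f} f≥0 zero =
  subst (ℚ._≤ sumF f) (+-identityʳ (f zero)) (+-mono-≤ (≤-refl {f zero}) (sumF-nonneg (f≥0 ∘ suc)))
term≤sumF {suc n} {f} f≥0 (suc i) =
  subst (ℚ._≤ sumF f) (+-identityˡ (f (suc i))) (+-mono-≤ (f≥0 zero) (term≤sumF (f≥0 ∘ suc) i))

sumF≡0⇒term≡0 : ∀ {n} {f : Vector n} → (∀ i → 0ℚ ℚ.≤ f i) → sumF f ≡ 0ℚ → ∀ i → f i ≡ 0ℚ
sumF≡0⇒term≡0 {f = f} f≥0 Σf≡0 i = ≤-antisym (subst (f i ℚ.≤_) Σf≡0 (term≤sumF f≥0 i)) (f≥0 i)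

ℕtoℚ≡mkℚ : ∀ m → ℕtoℚ m ≡ mkℚ (pos m) 0 (coprime-sym (1-coprimeTo m))
ℕtoℚ≡mkℚ m = ↥p/↧p≡p (mkℚ (pos m) 0 (coprime-sym (1-coprimeTo m)))

-- The middle line is what 1ℚ + mkℚ (pos m) 0 _ computes to.
ℕtoℚ-suc : ∀ m → ℕtoℚ (suc m) ≡ 1ℚ + ℕtoℚ m
ℕtoℚ-suc m = begin
  ℕtoℚ (suc m)                                 ≡⟨ cong (λ z → z ℚ./ 1) (cong (λ z → pos 1 ℤ.+ z) (ℤP.*-identityʳ (pos m))) ⟨
  (pos 1 ℤ.* pos 1 ℤ.+ pos m ℤ.* pos 1) ℚ./ 1  ≡⟨ cong (1ℚ +_) (ℕtoℚ≡mkℚ m) ⟨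
  1ℚ + ℕtoℚ m                                  ∎

sumF-const : ∀ {n} a → sumF {n} (λ _ → a) ≡ ℕtoℚ n * a
sumF-const {zero}  a = sym (*-zeroˡ a)
sumF-const {suc n} a = begin
  a + sumF {n} (λ _ → a)    ≡⟨ cong (a +_) (sumF-const {n} a) ⟩
  a + ℕtoℚ n * a            ≡⟨ solve 2 (λ a m → a :+ m :* a := (con 1ℚ :+ m) :* a) refl a (ℕtoℚ n) ⟩
  (1ℚ + ℕtoℚ n) * a         ≡⟨ cong (_* a) (ℕtoℚ-suc n) ⟨
  ℕtoℚ (suc n) * a          ∎

-- inv (suc k) is definitionally ↥ (1/ p) / ↧ₙ (1/ p).
inv-*-ℕtoℚ : ∀ n .{{_ : NonZero n}} → inv n * ℕtoℚ n ≡ 1ℚ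
inv-*-ℕtoℚ (suc k) = trans (cong₂ _*_ (↥p/↧p≡p (1/ p)) (ℕtoℚ≡mkℚ (suc k))) (*-inverseˡ p)
  where
  p : ℚ
  p = mkℚ (pos (suc k)) 0 (coprime-sym (1-coprimeTo (suc k)))

sumF-inv : ∀ n .{{_ : NonZero n}} → sumF {n} (λ _ → inv n) ≡ 1ℚ
sumF-inv n = trans (sumF-const {n} (inv n)) (trans (*-comm (ℕtoℚ n) (inv n)) (inv-*-ℕtoℚ n))

inv≢1 : ∀ m → inv (suc (suc m)) ≢ 1ℚ
inv≢1 m c≡1 = 2+m≢1 (cong ↥_ (begin
  mkℚ (pos (suc (suc m))) 0 _  ≡⟨ ℕtoℚ≡mkℚ (suc (suc m)) ⟨
  ℕtoℚ (suc (suc m))            ≡⟨ *-identityˡ _ ⟨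
  1ℚ * ℕtoℚ (suc (suc m))       ≡⟨ cong (_* ℕtoℚ (suc (suc m))) c≡1 ⟨
  inv (suc (suc m)) * ℕtoℚ (suc (suc m)) ≡⟨ inv-*-ℕtoℚ (suc (suc m)) ⟩
  1ℚ                            ∎))
  where
  2+m≢1 : pos (suc (suc m)) ≢ pos 1
  2+m≢1 ()

inv-pos : ∀ n .{{_ : NonZero n}} → ℚ.Positive (inv n)
inv-pos (suc k) = normalize-pos 1 (suc k)

square-nonneg : ∀ x → 0ℚ ℚ.≤ x * x
square-nonneg x with ≤-total 0ℚ x
... | inj₁ 0≤x = nonNegative⁻¹ (x * x) {{nonNeg*nonNeg⇒nonNeg x {{nonNegative 0≤x}} x {{nonNegative 0≤x}}}}
... | inj₂ x≤0 = nonNegative⁻¹ (x * x) {{nonPos*nonPos⇒nonPos x {{nonPositive x≤0}} x {{nonPositive x≤0}}}}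

square≡0⇒≡0 : ∀ x → x * x ≡ 0ℚ → x ≡ 0ℚ
square≡0⇒≡0 x x²≡0 with <-cmp x 0ℚ
... | tri< x<0 _ _ = ⊥-elim (<⇒≢ (positive⁻¹ (x * x) {{neg*neg⇒pos x {{negative x<0}} x {{negative x<0}}}}) (sym x²≡0))
... | tri≈ _ x≡0 _ = x≡0
... | tri> _ _ x>0 = ⊥-elim (<⇒≢ (positive⁻¹ (x * x) {{pos*pos⇒pos x {{positive x>0}} x {{positive x>0}}}}) (sym x²≡0))

RowSumsZero : ∀ {n} → Matrix n → Set
RowSumsZero A = ∀ i → sumF (A i) ≡ 0ℚ

ColSumsZero : ∀ {n} → Matrix n → Set
ColSumsZero A = ∀ j → sumF (λ i → A i j) ≡ 0ℚ

diagonal : ∀ {n} → Matrix n → Vector n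
diagonal A i = A i i

dot : ∀ {n} → Vector n → Vector n → ℚ
dot u v = sumF (λ i → u i * v i)

-- Id and diagM Y are definitionally Diag 𝟏 and Diag (diagonal Y), so the Diag lemmas serve all three.
Diag-off : ∀ {n} (v : Vector n) {i j} → i ≢ j → Diag v i j ≡ 0ℚ
Diag-off v {i} {j} i≢j rewrite dec-false (i ≟ j) i≢j = refl

Diag-on : ∀ {n} (v : Vector n) i → Diag v i i ≡ v i
Diag-on v i rewrite dec-true (i ≟ i) refl = refl

sumF-Diag-row : ∀ {n} (v : Vector n) i → sumF (Diag v i) ≡ v i
sumF-Diag-row v i = trans (sumF-single (Diag v i) i (λ k k≢i → Diag-off v (k≢i ∘ sym))) (Diag-on v i)

sumF-Diag-col : ∀ {n} (v : Vector n) j → sumF (λ i → Diag v i j) ≡ v j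
sumF-Diag-col v j = trans (sumF-single (λ i → Diag v i j) j (λ k → Diag-off v)) (Diag-on v j)

mv-Diag : ∀ {n} (v w : Vector n) i → mv (Diag v) w i ≡ v i * w i
mv-Diag v w i = trans
  (sumF-single (λ k → Diag v i k * w k) i (λ k k≢i → trans (cong (_* w k) (Diag-off v (k≢i ∘ sym))) (*-zeroˡ (w k))))
  (cong (_* w i) (Diag-on v i))

vm-Diag : ∀ {n} (v w : Vector n) j → vm w (Diag v) j ≡ w j * v j
vm-Diag v w j = trans
  (sumF-single (λ k → w k * Diag v k j) j (λ k k≢j → trans (cong (w k *_) (Diag-off v k≢j)) (*-zeroʳ (w k))))
  (cong (w j *_) (Diag-on v j))

mv-cong : ∀ {n} (A : Matrix n) {u v : Vector n} → (∀ k → u k ≡ v k) → ∀ i → mv A u i ≡ mv A v i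
mv-cong A u≗v i = sumF-cong (λ k → cong (A i k *_) (u≗v k))

vm-cong : ∀ {n} (A : Matrix n) {u v : Vector n} → (∀ k → u k ≡ v k) → ∀ j → vm u A j ≡ vm v A j
vm-cong A u≗v j = sumF-cong (λ k → cong (_* A k j) (u≗v k))

⊗-congˡ : ∀ {n} {A A′ : Matrix n} (B : Matrix n) → A ≐ A′ → (A ⊗ B) ≐ (A′ ⊗ B)
⊗-congˡ B A≐A′ i = vm-cong B (A≐A′ i)

⊗-congʳ : ∀ {n} (A : Matrix n) {B B′ : Matrix n} → B ≐ B′ → (A ⊗ B) ≐ (A ⊗ B′)
⊗-congʳ A B≐B′ i j = mv-cong A (λ k → B≐B′ k j) i

mv-⊗ : ∀ {n} (A B : Matrix n) v i → mv (A ⊗ B) v i ≡ mv A (mv B v) i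
mv-⊗ A B v i = begin
  sumF (λ k → sumF (λ l → A i l * B l k) * v k)  ≡⟨ sumF-cong (λ k → sumF-*ʳ (v k) (λ l → A i l * B l k)) ⟨
  sumF (λ k → sumF (λ l → A i l * B l k * v k))  ≡⟨ sumF-comm (λ k l → A i l * B l k * v k) ⟩
  sumF (λ l → sumF (λ k → A i l * B l k * v k))  ≡⟨ sumF-cong (λ l → trans
                                                       (sumF-cong (λ k → *-assoc (A i l) (B l k) (v k)))
                                                       (sumF-*ˡ (A i l) (λ k → B l k * v k))) ⟩
  sumF (λ l → A i l * sumF (λ k → B l k * v k))  ∎

⊗-assoc : ∀ {n} (A B C : Matrix n) → ((A ⊗ B) ⊗ C) ≐ (A ⊗ (B ⊗ C))
⊗-assoc A B C i j = mv-⊗ A B (λ k → C k j) i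

mv-⊗-Diag-𝟏 : ∀ {n} (A : Matrix n) v i → mv (A ⊗ Diag v) 𝟏 i ≡ mv A v i
mv-⊗-Diag-𝟏 A v i = sumF-cong (λ k → trans (*-identityʳ _) (vm-Diag v (A i) k))

vm-⊖-transpose : ∀ {n} (A : Matrix n) v j → vm v (A ⊖ transpose A) j ≡ vm v A j - mv A v j
vm-⊖-transpose A v j = begin
  sumF (λ k → v k * (A k j - A j k))           ≡⟨ sumF-cong (λ k → x[y-z]≈xy-xz (v k) (A k j) (A j k)) ⟩
  sumF (λ k → v k * A k j - v k * A j k)       ≡⟨ sumF-- (λ k → v k * A k j) (λ k → v k * A j k) ⟩
  vm v A j - sumF (λ k → v k * A j k)          ≡⟨ cong (λ s → vm v A j - s) (sumF-cong (λ k → *-comm (v k) (A j k))) ⟩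
  vm v A j - mv A v j                          ∎

sumF-mv : ∀ {n} (A : Matrix n) v → sumF (mv A v) ≡ sumF (λ k → sumF (λ i → A i k) * v k)
sumF-mv A v = trans (sumF-comm (λ i k → A i k * v k)) (sumF-cong (λ k → sumF-*ʳ (v k) (λ i → A i k)))

sumF-vm : ∀ {n} (A : Matrix n) v → sumF (vm v A) ≡ sumF (λ k → v k * sumF (A k))
sumF-vm A v = trans (sumF-comm (λ j k → v k * A k j)) (sumF-cong (λ k → sumF-*ˡ (v k) (A k)))

colSumsZero⇒sumF-mv≡0 : ∀ {n} {A : Matrix n} → ColSumsZero A → ∀ v → sumF (mv A v) ≡ 0ℚ
colSumsZero⇒sumF-mv≡0 {A = A} colA v =
  trans (sumF-mv A v) (sumF-zero (λ k → trans (cong (_* v k) (colA k)) (*-zeroˡ (v k))))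

rowSumsZero⇒sumF-vm≡0 : ∀ {n} {A : Matrix n} → RowSumsZero A → ∀ v → sumF (vm v A) ≡ 0ℚ
rowSumsZero⇒sumF-vm≡0 {A = A} rowA v =
  trans (sumF-vm A v) (sumF-zero (λ k → trans (cong (v k *_) (rowA k)) (*-zeroʳ (v k))))

⊗-rowSumsZero : ∀ {n} (A : Matrix n) {B : Matrix n} → RowSumsZero B → RowSumsZero (A ⊗ B)
⊗-rowSumsZero A rowB i = rowSumsZero⇒sumF-vm≡0 rowB (A i)

⊗-colSumsZero : ∀ {n} {A : Matrix n} (B : Matrix n) → ColSumsZero A → ColSumsZero (A ⊗ B)
⊗-colSumsZero B colA j = colSumsZero⇒sumF-mv≡0 colA (λ k → B k j)

symmetric⇒colSumsZero : ∀ {n} {A : Matrix n} → transpose A ≐ A → RowSumsZero A → ColSumsZero A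
symmetric⇒colSumsZero symA rowA j = trans (sumF-cong (λ i → symA j i)) (rowA j)

symmetric⇒rowSumsZero : ∀ {n} {A : Matrix n} → transpose A ≐ A → ColSumsZero A → RowSumsZero A
symmetric⇒rowSumsZero symA colA i = trans (sumF-cong (λ j → sym (symA i j))) (colA i)

dot-+ʳ : ∀ {n} (u v : Vector n) a → dot u (λ k → v k + a) ≡ dot u v + sumF u * a
dot-+ʳ u v a = begin
  sumF (λ k → u k * (v k + a))        ≡⟨ sumF-cong (λ k → *-distribˡ-+ (u k) (v k) a) ⟩
  sumF (λ k → u k * v k + u k * a)    ≡⟨ sumF-+ (λ k → u k * v k) (λ k → u k * a) ⟩
  dot u v + sumF (λ k → u k * a)      ≡⟨ cong (dot u v +_) (sumF-*ʳ a u) ⟩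
  dot u v + sumF u * a                ∎

dot-+ˡ : ∀ {n} (u v : Vector n) a → dot (λ k → u k + a) v ≡ dot u v + a * sumF v
dot-+ˡ u v a = begin
  sumF (λ k → (u k + a) * v k)        ≡⟨ sumF-cong (λ k → *-distribʳ-+ (v k) (u k) a) ⟩
  sumF (λ k → u k * v k + a * v k)    ≡⟨ sumF-+ (λ k → u k * v k) (λ k → a * v k) ⟩
  dot u v + sumF (λ k → a * v k)      ≡⟨ cong (dot u v +_) (sumF-*ˡ a v) ⟩
  dot u v + a * sumF v                ∎

quad≡dot : ∀ {n} (v : Vector n) A → quad v A ≡ dot v (mv A v)
quad≡dot v A = sumF-cong (λ i → trans
  (sumF-cong (λ j → *-assoc (v i) (A i j) (v j)))
  (sumF-*ˡ (v i) (λ j → A i j * v j)))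

quad-cong : ∀ {n} {u v : Vector n} (A : Matrix n) → (∀ k → u k ≡ v k) → quad u A ≡ quad v A
quad-cong A u≗v = sumF-cong (λ i → sumF-cong (λ j → cong₂ (λ p q → p * A i j * q) (u≗v i) (u≗v j)))

rowSumsZero⇒mv-shift : ∀ {n} {A : Matrix n} → RowSumsZero A → ∀ v a i → mv A (λ k → v k + a) i ≡ mv A v i
rowSumsZero⇒mv-shift {A = A} rowA v a i = begin
  mv A (λ k → v k + a) i      ≡⟨ dot-+ʳ (A i) v a ⟩
  mv A v i + sumF (A i) * a   ≡⟨ cong (λ s → mv A v i + s * a) (rowA i) ⟩
  mv A v i + 0ℚ * a           ≡⟨ solve 2 (λ p a → p :+ con 0ℚ :* a := p) refl (mv A v i) a ⟩
  mv A v i                    ∎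

colSumsZero⇒vm-shift : ∀ {n} {A : Matrix n} → ColSumsZero A → ∀ v a j → vm (λ k → v k + a) A j ≡ vm v A j
colSumsZero⇒vm-shift {A = A} colA v a j = begin
  vm (λ k → v k + a) A j              ≡⟨ dot-+ˡ v (λ k → A k j) a ⟩
  vm v A j + a * sumF (λ k → A k j)   ≡⟨ cong (λ s → vm v A j + a * s) (colA j) ⟩
  vm v A j + a * 0ℚ                   ≡⟨ solve 2 (λ p a → p :+ a :* con 0ℚ := p) refl (vm v A j) a ⟩
  vm v A j                            ∎

sumsZero⇒quad-shift : ∀ {n} {A : Matrix n} → RowSumsZero A → ColSumsZero A →
                      ∀ v a → quad (λ k → v k + a) A ≡ quad v A
sumsZero⇒quad-shift {A = A} rowA colA v a = begin
  quad (λ k → v k + a) A                         ≡⟨ quad≡dot (λ k → v k + a) A ⟩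
  dot (λ k → v k + a) (mv A (λ k → v k + a))     ≡⟨ sumF-cong (λ k → cong ((v k + a) *_) (rowSumsZero⇒mv-shift rowA v a k)) ⟩
  dot (λ k → v k + a) (mv A v)                   ≡⟨ dot-+ˡ v (mv A v) a ⟩
  dot v (mv A v) + a * sumF (mv A v)             ≡⟨ cong (λ s → dot v (mv A v) + a * s) (colSumsZero⇒sumF-mv≡0 colA v) ⟩
  dot v (mv A v) + a * 0ℚ                        ≡⟨ solve 2 (λ p a → p :+ a :* con 0ℚ := p) refl (dot v (mv A v)) a ⟩
  dot v (mv A v)                                 ≡⟨ quad≡dot v A ⟨
  quad v A                                       ∎

Centering : ∀ n → Matrix n
Centering n i j = Id i j - inv n

Centering-diagonal : ∀ {n} (i : Fin n) → Centering n i i ≡ 1ℚ - inv n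
Centering-diagonal {n} i = cong (_- inv n) (Diag-on 𝟏 i)

mv-Centering : ∀ {n} (v : Vector n) i → mv (Centering n) v i ≡ v i - inv n * sumF v
mv-Centering {n} v i = begin
  sumF (λ k → (Id i k - inv n) * v k)              ≡⟨ sumF-cong (λ k → [y-z]x≈yx-zx (v k) (Id i k) (inv n)) ⟩
  sumF (λ k → Id i k * v k - inv n * v k)          ≡⟨ sumF-- (λ k → Id i k * v k) (λ k → inv n * v k) ⟩
  mv Id v i - sumF (λ k → inv n * v k)             ≡⟨ cong₂ _-_ (trans (mv-Diag 𝟏 v i) (*-identityˡ (v i))) (sumF-*ˡ (inv n) v) ⟩
  v i - inv n * sumF v                             ∎

vm-Centering : ∀ {n} (v : Vector n) j → vm v (Centering n) j ≡ v j - inv n * sumF v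
vm-Centering {n} v j = begin
  sumF (λ k → v k * (Id k j - inv n))              ≡⟨ sumF-cong (λ k → x[y-z]≈xy-xz (v k) (Id k j) (inv n)) ⟩
  sumF (λ k → v k * Id k j - v k * inv n)          ≡⟨ sumF-- (λ k → v k * Id k j) (λ k → v k * inv n) ⟩
  vm v Id j - sumF (λ k → v k * inv n)             ≡⟨ cong₂ _-_ (trans (vm-Diag 𝟏 v j) (*-identityʳ (v j))) (sumF-*ʳ (inv n) v) ⟩
  v j - sumF v * inv n                             ≡⟨ cong (λ s → v j - s) (*-comm (sumF v) (inv n)) ⟩
  v j - inv n * sumF v                             ∎

Centering-identityˡ : ∀ {n} {B : Matrix n} → ColSumsZero B → (Centering n ⊗ B) ≐ B
Centering-identityˡ {n} {B} colB i j = begin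
  mv (Centering n) (λ k → B k j) i   ≡⟨ mv-Centering (λ k → B k j) i ⟩
  B i j - inv n * sumF (λ k → B k j) ≡⟨ cong (λ s → B i j - inv n * s) (colB j) ⟩
  B i j - inv n * 0ℚ                 ≡⟨ solve 2 (λ b c → b :- c :* con 0ℚ := b) refl (B i j) (inv n) ⟩
  B i j                              ∎

Centering-identityʳ : ∀ {n} {B : Matrix n} → RowSumsZero B → (B ⊗ Centering n) ≐ B
Centering-identityʳ {n} {B} rowB i j = begin
  vm (B i) (Centering n) j           ≡⟨ vm-Centering (B i) j ⟩
  B i j - inv n * sumF (B i)         ≡⟨ cong (λ s → B i j - inv n * s) (rowB i) ⟩
  B i j - inv n * 0ℚ                 ≡⟨ solve 2 (λ b c → b :- c :* con 0ℚ := b) refl (B i j) (inv n) ⟩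
  B i j                              ∎

Centering-colSumsZero : ∀ n .{{_ : NonZero n}} → ColSumsZero (Centering n)
Centering-colSumsZero n j = begin
  sumF (λ i → Id i j - inv n)        ≡⟨ sumF-- (λ i → Id i j) (λ _ → inv n) ⟩
  sumF (λ i → Id i j) - sumF {n} (λ _ → inv n) ≡⟨ cong₂ _-_ (sumF-Diag-col 𝟏 j) (sumF-inv n) ⟩
  1ℚ - 1ℚ                            ≡⟨ +-inverseʳ 1ℚ ⟩
  0ℚ                                 ∎

degree≡sumF-adj : ∀ {n} (E : Digraph n) i → mv (adj E) 𝟏 i ≡ sumF (adj E i)
degree≡sumF-adj E i = sumF-cong (λ k → *-identityʳ (adj E i k))

Laplacian-rowSumsZero : ∀ {n} (E : Digraph n) → RowSumsZero (Laplacian E)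
Laplacian-rowSumsZero E i = begin
  sumF (λ j → Diag (mv (adj E) 𝟏) i j - adj E i j)  ≡⟨ sumF-- (Diag (mv (adj E) 𝟏) i) (adj E i) ⟩
  sumF (Diag (mv (adj E) 𝟏) i) - sumF (adj E i)     ≡⟨ cong (_- sumF (adj E i)) (sumF-Diag-row (mv (adj E) 𝟏) i) ⟩
  mv (adj E) 𝟏 i - sumF (adj E i)                   ≡⟨ cong (_- sumF (adj E i)) (degree≡sumF-adj E i) ⟩
  sumF (adj E i) - sumF (adj E i)                   ≡⟨ +-inverseʳ (sumF (adj E i)) ⟩
  0ℚ                                                ∎

Laplacian-colSumsZero : ∀ {n} {E : Digraph n} → Balanced E → ColSumsZero (Laplacian E)
Laplacian-colSumsZero {E = E} balanced j = begin
  sumF (λ i → Diag (mv (adj E) 𝟏) i j - adj E i j)            ≡⟨ sumF-- (λ i → Diag (mv (adj E) 𝟏) i j) (λ i → adj E i j) ⟩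
  sumF (λ i → Diag (mv (adj E) 𝟏) i j) - sumF (λ i → adj E i j) ≡⟨ cong₂ _-_ (sumF-Diag-col (mv (adj E) 𝟏) j) (balanced j) ⟩
  mv (adj E) 𝟏 j - sumF (adj E j)                             ≡⟨ cong (_- sumF (adj E j)) (degree≡sumF-adj E j) ⟩
  sumF (adj E j) - sumF (adj E j)                             ≡⟨ +-inverseʳ (sumF (adj E j)) ⟩
  0ℚ                                                          ∎

Laplacian-mv : ∀ {n} (E : Digraph n) w i → mv (Laplacian E) w i ≡ sumF (λ j → adj E i j * (w i - w j))
Laplacian-mv {n} E w i = begin
  sumF (λ j → (deg i j - adj E i j) * w j)              ≡⟨ sumF-cong (λ j → [y-z]x≈yx-zx (w j) (deg i j) (adj E i j)) ⟩
  sumF (λ j → deg i j * w j - adj E i j * w j)          ≡⟨ sumF-- (λ j → deg i j * w j) (λ j → adj E i j * w j) ⟩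
  mv (Diag (mv (adj E) 𝟏)) w i - mv (adj E) w i        ≡⟨ cong (_- mv (adj E) w i) (mv-Diag (mv (adj E) 𝟏) w i) ⟩
  mv (adj E) 𝟏 i * w i - mv (adj E) w i                 ≡⟨ cong (λ s → s * w i - mv (adj E) w i) (degree≡sumF-adj E i) ⟩
  sumF (adj E i) * w i - mv (adj E) w i                 ≡⟨ cong (_- mv (adj E) w i) (sumF-*ʳ (w i) (adj E i)) ⟨
  sumF (λ j → adj E i j * w i) - mv (adj E) w i         ≡⟨ sumF-- (λ j → adj E i j * w i) (λ j → adj E i j * w j) ⟨
  sumF (λ j → adj E i j * w i - adj E i j * w j)        ≡⟨ sumF-cong (λ j → x[y-z]≈xy-xz (adj E i j) (w i) (w j)) ⟨
  sumF (λ j → adj E i j * (w i - w j))                  ∎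
  where
  deg : Matrix n
  deg = Diag (mv (adj E) 𝟏)

if-edge≡adj-* : ∀ {n} (E : Digraph n) i j r → (if E i j then r else 0ℚ) ≡ adj E i j * r
if-edge≡adj-* E i j r with E i j
... | true  = sym (*-identityˡ r)
... | false = sym (*-zeroˡ r)

tauVec-Laplacian : ∀ {n} (E : Digraph n) (R : Matrix n) → (∀ i → R i i ≡ 0ℚ) →
                   ∀ i → tauVec E R i ≡ ℕtoℚ 2 + (Laplacian E ⊗ R) i i
tauVec-Laplacian E R R-diag i = begin
  ℕtoℚ 2 - sumF (λ j → if E i j then R j i else 0ℚ)
    ≡⟨ cong (λ s → ℕtoℚ 2 - s) (sumF-cong (λ j → if-edge≡adj-* E i j (R j i))) ⟩
  ℕtoℚ 2 - sumF (λ j → adj E i j * R j i)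
    ≡⟨ cong (ℕtoℚ 2 +_) (sumF-neg (λ j → adj E i j * R j i)) ⟨
  ℕtoℚ 2 + sumF (λ j → - (adj E i j * R j i))
    ≡⟨ cong (ℕtoℚ 2 +_) (sumF-cong edge-term) ⟩
  ℕtoℚ 2 + sumF (λ j → adj E i j * (R i i - R j i))
    ≡⟨ cong (ℕtoℚ 2 +_) (Laplacian-mv E (λ j → R j i) i) ⟨
  ℕtoℚ 2 + (Laplacian E ⊗ R) i i
    ∎
  where
  edge-term : ∀ j → - (adj E i j * R j i) ≡ adj E i j * (R i i - R j i)
  edge-term j = trans
    (solve 2 (λ a r → :- (a :* r) := a :* (con 0ℚ :- r)) refl (adj E i j) (R j i))
    (cong (λ z → adj E i j * (z - R j i)) (sym (R-diag i)))

dirichlet : ∀ {n} → Digraph n → Vector n → ℚ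
dirichlet E w = sumF (λ i → sumF (λ j → adj E i j * ((w i - w j) * (w i - w j))))

-- Termwise a (x - y)² = 2 x · a (x - y) − a (x² − y²); the second part sums to Σᵢ (L w²)ᵢ, which
-- vanishes because a balanced Laplacian has zero column sums.
dirichlet≡2*quad : ∀ {n} {E : Digraph n} → Balanced E → ∀ (w : Vector n) →
                   dirichlet E w ≡ ℕtoℚ 2 * quad w (Laplacian E)
dirichlet≡2*quad {n} {E} balanced w = begin
  dirichlet E w
    ≡⟨ sumF-cong row ⟩
  sumF (λ i → ℕtoℚ 2 * (w i * mv L w i) - mv L w² i)
    ≡⟨ sumF-- (λ i → ℕtoℚ 2 * (w i * mv L w i)) (mv L w²) ⟩
  sumF (λ i → ℕtoℚ 2 * (w i * mv L w i)) - sumF (mv L w²)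
    ≡⟨ cong₂ _-_ (sumF-*ˡ (ℕtoℚ 2) (λ i → w i * mv L w i)) (colSumsZero⇒sumF-mv≡0 (Laplacian-colSumsZero balanced) w²) ⟩
  ℕtoℚ 2 * dot w (mv L w) - 0ℚ
    ≡⟨ solve 1 (λ q → q :- con 0ℚ := q) refl (ℕtoℚ 2 * dot w (mv L w)) ⟩
  ℕtoℚ 2 * dot w (mv L w)
    ≡⟨ cong (ℕtoℚ 2 *_) (quad≡dot w L) ⟨
  ℕtoℚ 2 * quad w L
    ∎
  where
  L : Matrix n
  L = Laplacian E

  w² : Vector n
  w² k = w k * w k

  row : ∀ i → sumF (λ j → adj E i j * ((w i - w j) * (w i - w j))) ≡ ℕtoℚ 2 * (w i * mv L w i) - mv L w² i
  row i = begin
    sumF (λ j → adj E i j * ((w i - w j) * (w i - w j)))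
      ≡⟨ sumF-cong (λ j → solve 3 (λ a x y → a :* ((x :- y) :* (x :- y))
                                    := con (ℕtoℚ 2) :* (x :* (a :* (x :- y))) :- a :* (x :* x :- y :* y))
                                  refl (adj E i j) (w i) (w j)) ⟩
    sumF (λ j → ℕtoℚ 2 * (w i * (adj E i j * (w i - w j))) - adj E i j * (w² i - w² j))
      ≡⟨ sumF-- (λ j → ℕtoℚ 2 * (w i * (adj E i j * (w i - w j)))) (λ j → adj E i j * (w² i - w² j)) ⟩
    sumF (λ j → ℕtoℚ 2 * (w i * (adj E i j * (w i - w j)))) - sumF (λ j → adj E i j * (w² i - w² j))
      ≡⟨ cong (_- sumF (λ j → adj E i j * (w² i - w² j))) (trans
           (sumF-*ˡ (ℕtoℚ 2) (λ j → w i * (adj E i j * (w i - w j))))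
           (cong (ℕtoℚ 2 *_) (sumF-*ˡ (w i) (λ j → adj E i j * (w i - w j))))) ⟩
    ℕtoℚ 2 * (w i * sumF (λ j → adj E i j * (w i - w j))) - sumF (λ j → adj E i j * (w² i - w² j))
      ≡⟨ cong₂ (λ p q → ℕtoℚ 2 * (w i * p) - q) (Laplacian-mv E w i) (Laplacian-mv E w² i) ⟨
    ℕtoℚ 2 * (w i * mv L w i) - mv L w² i
      ∎

edge-term-nonneg : ∀ {n} (E : Digraph n) i j y → 0ℚ ℚ.≤ adj E i j * (y * y)
edge-term-nonneg E i j y with E i j
... | true  = subst (0ℚ ℚ.≤_) (sym (*-identityˡ (y * y))) (square-nonneg y)
... | false = subst (0ℚ ℚ.≤_) (sym (*-zeroˡ (y * y))) ≤-refl

edge-term≡0 : ∀ {n} (E : Digraph n) i j y → adj E i j * (y * y) ≡ 0ℚ → adj E i j * y ≡ 0ℚ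
edge-term≡0 E i j y ay²≡0 with E i j
... | true  = trans (*-identityˡ y) (square≡0⇒≡0 y (trans (sym (*-identityˡ (y * y))) ay²≡0))
... | false = *-zeroˡ y

dirichlet-row-nonneg : ∀ {n} (E : Digraph n) (w : Vector n) i →
                       0ℚ ℚ.≤ sumF (λ j → adj E i j * ((w i - w j) * (w i - w j)))
dirichlet-row-nonneg E w i = sumF-nonneg (λ j → edge-term-nonneg E i j (w i - w j))

dirichlet≡0⇒Laplacian-mv≡0 : ∀ {n} (E : Digraph n) (w : Vector n) →
                             dirichlet E w ≡ 0ℚ → ∀ i → mv (Laplacian E) w i ≡ 0ℚ
dirichlet≡0⇒Laplacian-mv≡0 E w D≡0 i = trans (Laplacian-mv E w i) (sumF-zero (λ j →
  edge-term≡0 E i j (w i - w j)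
    (sumF≡0⇒term≡0 (λ j → edge-term-nonneg E i j (w i - w j))
      (sumF≡0⇒term≡0 (dirichlet-row-nonneg E w) D≡0 i) j)))

Laplacian-quad-nonneg : ∀ {n} {E : Digraph n} → Balanced E → ∀ (w : Vector n) → 0ℚ ℚ.≤ quad w (Laplacian E)
Laplacian-quad-nonneg {E = E} balanced w = *-cancelˡ-≤-pos (ℕtoℚ 2)
  (subst₂ ℚ._≤_ (sym (*-zeroʳ (ℕtoℚ 2))) (dirichlet≡2*quad balanced w) (sumF-nonneg (dirichlet-row-nonneg E w)))

Laplacian-quad≡0⇒mv≡0 : ∀ {n} {E : Digraph n} → Balanced E → ∀ (w : Vector n) →
                        quad w (Laplacian E) ≡ 0ℚ → ∀ i → mv (Laplacian E) w i ≡ 0ℚ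
Laplacian-quad≡0⇒mv≡0 {E = E} balanced w q≡0 = dirichlet≡0⇒Laplacian-mv≡0 E w
  (trans (dirichlet≡2*quad balanced w) (trans (cong (ℕtoℚ 2 *_) q≡0) (*-zeroʳ (ℕtoℚ 2))))

resistance-diagonal : ∀ {n} (Q : Matrix n) i → resistance Q i i ≡ 0ℚ
resistance-diagonal Q i = solve 1 (λ q → q :+ q :- con (ℕtoℚ 2) :* q := con 0ℚ) refl (Q i i)

mv-resistance : ∀ {n} (Q : Matrix n) v i →
                mv (resistance Q) v i ≡ Q i i * sumF v + dot (diagonal Q) v - ℕtoℚ 2 * mv Q v i
mv-resistance Q v i = begin
  sumF (λ k → (Q i i + Q k k - ℕtoℚ 2 * Q i k) * v k)
    ≡⟨ sumF-cong (λ k → solve 4 (λ a b q x → (a :+ b :- con (ℕtoℚ 2) :* q) :* x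
                                   := (a :* x :+ b :* x) :- con (ℕtoℚ 2) :* (q :* x))
                                 refl (Q i i) (Q k k) (Q i k) (v k)) ⟩
  sumF (λ k → (Q i i * v k + Q k k * v k) - ℕtoℚ 2 * (Q i k * v k))
    ≡⟨ sumF-- (λ k → Q i i * v k + Q k k * v k) (λ k → ℕtoℚ 2 * (Q i k * v k)) ⟩
  sumF (λ k → Q i i * v k + Q k k * v k) - sumF (λ k → ℕtoℚ 2 * (Q i k * v k))
    ≡⟨ cong₂ _-_ (sumF-+ (λ k → Q i i * v k) (λ k → Q k k * v k)) (sumF-*ˡ (ℕtoℚ 2) (λ k → Q i k * v k)) ⟩
  sumF (λ k → Q i i * v k) + dot (diagonal Q) v - ℕtoℚ 2 * mv Q v i
    ≡⟨ cong (λ s → s + dot (diagonal Q) v - ℕtoℚ 2 * mv Q v i) (sumF-*ˡ (Q i i) v) ⟩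
  Q i i * sumF v + dot (diagonal Q) v - ℕtoℚ 2 * mv Q v i
    ∎

vm-resistance : ∀ {n} (Q : Matrix n) v j →
                vm v (resistance Q) j ≡ dot v (diagonal Q) + sumF v * Q j j - ℕtoℚ 2 * vm v Q j
vm-resistance Q v j = begin
  sumF (λ k → v k * (Q k k + Q j j - ℕtoℚ 2 * Q k j))
    ≡⟨ sumF-cong (λ k → solve 4 (λ x a b q → x :* (a :+ b :- con (ℕtoℚ 2) :* q)
                                   := (x :* a :+ x :* b) :- con (ℕtoℚ 2) :* (x :* q))
                                 refl (v k) (Q k k) (Q j j) (Q k j)) ⟩
  sumF (λ k → (v k * Q k k + v k * Q j j) - ℕtoℚ 2 * (v k * Q k j))
    ≡⟨ sumF-- (λ k → v k * Q k k + v k * Q j j) (λ k → ℕtoℚ 2 * (v k * Q k j)) ⟩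
  sumF (λ k → v k * Q k k + v k * Q j j) - sumF (λ k → ℕtoℚ 2 * (v k * Q k j))
    ≡⟨ cong₂ _-_ (sumF-+ (λ k → v k * Q k k) (λ k → v k * Q j j)) (sumF-*ˡ (ℕtoℚ 2) (λ k → v k * Q k j)) ⟩
  dot v (diagonal Q) + sumF (λ k → v k * Q j j) - ℕtoℚ 2 * vm v Q j
    ≡⟨ cong (λ s → dot v (diagonal Q) + s - ℕtoℚ 2 * vm v Q j) (sumF-*ʳ (Q j j) v) ⟩
  dot v (diagonal Q) + sumF v * Q j j - ℕtoℚ 2 * vm v Q j
    ∎

module CentredInverse {n : ℕ} {{_ : NonZero n}} {L X : Matrix n}
  (rowL : RowSumsZero L) (colL : ColSumsZero L)
  (inverse : IsInverse (L ⊕ scale (inv n) Jm) X) where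

  private
    K : Matrix n
    K = L ⊕ scale (inv n) Jm

    sumF-J-entries : sumF {n} (λ _ → inv n * 1ℚ) ≡ 1ℚ
    sumF-J-entries = trans (sumF-cong {n} (λ _ → *-identityʳ (inv n))) (sumF-inv n)

    K-rowSums : ∀ i → sumF (K i) ≡ 1ℚ
    K-rowSums i = begin
      sumF (λ j → L i j + inv n * 1ℚ)              ≡⟨ sumF-+ (L i) (λ _ → inv n * 1ℚ) ⟩
      sumF (L i) + sumF {n} (λ _ → inv n * 1ℚ)     ≡⟨ cong₂ _+_ (rowL i) sumF-J-entries ⟩
      0ℚ + 1ℚ                                      ≡⟨ +-identityˡ 1ℚ ⟩
      1ℚ                                           ∎

    K-colSums : ∀ j → sumF (λ i → K i j) ≡ 1ℚ
    K-colSums j = begin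
      sumF (λ i → L i j + inv n * 1ℚ)              ≡⟨ sumF-+ (λ i → L i j) (λ _ → inv n * 1ℚ) ⟩
      sumF (λ i → L i j) + sumF {n} (λ _ → inv n * 1ℚ) ≡⟨ cong₂ _+_ (colL j) sumF-J-entries ⟩
      0ℚ + 1ℚ                                      ≡⟨ +-identityˡ 1ℚ ⟩
      1ℚ                                           ∎

  inverse-rowSums : ∀ i → sumF (X i) ≡ 1ℚ
  inverse-rowSums i = begin
    sumF (X i)                                   ≡⟨ sumF-cong (λ j → trans (cong (X i j *_) (K-rowSums j)) (*-identityʳ (X i j))) ⟨
    sumF (λ j → X i j * sumF (K j))              ≡⟨ sumF-vm K (X i) ⟨
    sumF (λ k → (X ⊗ K) i k)                     ≡⟨ sumF-cong (proj₂ inverse i) ⟩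
    sumF (Id i)                                  ≡⟨ sumF-Diag-row 𝟏 i ⟩
    1ℚ                                           ∎

  inverse-colSums : ∀ j → sumF (λ i → X i j) ≡ 1ℚ
  inverse-colSums j = begin
    sumF (λ i → X i j)                           ≡⟨ sumF-cong (λ i → trans (cong (_* X i j) (K-colSums i)) (*-identityˡ (X i j))) ⟨
    sumF (λ i → sumF (λ k → K k i) * X i j)      ≡⟨ sumF-mv K (λ i → X i j) ⟨
    sumF (λ k → (K ⊗ X) k j)                     ≡⟨ sumF-cong (λ k → proj₁ inverse k j) ⟩
    sumF (λ k → Id k j)                          ≡⟨ sumF-Diag-col 𝟏 j ⟩
    1ℚ                                           ∎

  ⊗-inverse : (L ⊗ X) ≐ Centering n
  ⊗-inverse i j = begin
    (L ⊗ X) i j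
      ≡⟨ solve 2 (λ a c → a := (a :+ c :* con 1ℚ :* con 1ℚ) :- c) refl ((L ⊗ X) i j) (inv n) ⟩
    (L ⊗ X) i j + inv n * 1ℚ * 1ℚ - inv n
      ≡⟨ cong (_- inv n) K⊗X-split ⟨
    (K ⊗ X) i j - inv n
      ≡⟨ cong (_- inv n) (proj₁ inverse i j) ⟩
    Centering n i j
      ∎
    where
    K⊗X-split : (K ⊗ X) i j ≡ (L ⊗ X) i j + inv n * 1ℚ * 1ℚ
    K⊗X-split = begin
      sumF (λ k → (L i k + inv n * 1ℚ) * X k j)              ≡⟨ sumF-cong (λ k → *-distribʳ-+ (X k j) (L i k) (inv n * 1ℚ)) ⟩
      sumF (λ k → L i k * X k j + inv n * 1ℚ * X k j)        ≡⟨ sumF-+ (λ k → L i k * X k j) (λ k → inv n * 1ℚ * X k j) ⟩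
      (L ⊗ X) i j + sumF (λ k → inv n * 1ℚ * X k j)          ≡⟨ cong ((L ⊗ X) i j +_) (sumF-*ˡ (inv n * 1ℚ) (λ k → X k j)) ⟩
      (L ⊗ X) i j + inv n * 1ℚ * sumF (λ k → X k j)          ≡⟨ cong (λ s → (L ⊗ X) i j + inv n * 1ℚ * s) (inverse-colSums j) ⟩
      (L ⊗ X) i j + inv n * 1ℚ * 1ℚ                          ∎

  inverse-⊗ : (X ⊗ L) ≐ Centering n
  inverse-⊗ i j = begin
    (X ⊗ L) i j
      ≡⟨ solve 2 (λ a c → a := (a :+ con 1ℚ :* (c :* con 1ℚ)) :- c) refl ((X ⊗ L) i j) (inv n) ⟩
    (X ⊗ L) i j + 1ℚ * (inv n * 1ℚ) - inv n
      ≡⟨ cong (_- inv n) X⊗K-split ⟨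
    (X ⊗ K) i j - inv n
      ≡⟨ cong (_- inv n) (proj₂ inverse i j) ⟩
    Centering n i j
      ∎
    where
    X⊗K-split : (X ⊗ K) i j ≡ (X ⊗ L) i j + 1ℚ * (inv n * 1ℚ)
    X⊗K-split = begin
      sumF (λ k → X i k * (L k j + inv n * 1ℚ))              ≡⟨ sumF-cong (λ k → *-distribˡ-+ (X i k) (L k j) (inv n * 1ℚ)) ⟩
      sumF (λ k → X i k * L k j + X i k * (inv n * 1ℚ))      ≡⟨ sumF-+ (λ k → X i k * L k j) (λ k → X i k * (inv n * 1ℚ)) ⟩
      (X ⊗ L) i j + sumF (λ k → X i k * (inv n * 1ℚ))        ≡⟨ cong ((X ⊗ L) i j +_) (sumF-*ʳ (inv n * 1ℚ) (X i)) ⟩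
      (X ⊗ L) i j + sumF (X i) * (inv n * 1ℚ)                ≡⟨ cong (λ s → (X ⊗ L) i j + s * (inv n * 1ℚ)) (inverse-rowSums i) ⟩
      (X ⊗ L) i j + 1ℚ * (inv n * 1ℚ)                        ∎

  module MoorePenrose {Ld : Matrix n} (pinv : IsMoorePenrose L Ld) where

    private
      L⊗Ld⊗L : ((L ⊗ Ld) ⊗ L) ≐ L
      L⊗Ld⊗L = proj₁ pinv

      Ld⊗L⊗Ld : ((Ld ⊗ L) ⊗ Ld) ≐ Ld
      Ld⊗L⊗Ld = proj₁ (proj₂ pinv)

      L⊗Ld-symmetric : transpose (L ⊗ Ld) ≐ (L ⊗ Ld)
      L⊗Ld-symmetric = proj₁ (proj₂ (proj₂ pinv))

      Ld⊗L-symmetric : transpose (Ld ⊗ L) ≐ (Ld ⊗ L)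
      Ld⊗L-symmetric = proj₂ (proj₂ (proj₂ pinv))

    pinv-⊗ : (Ld ⊗ L) ≐ Centering n
    pinv-⊗ i j = begin
      (Ld ⊗ L) i j                     ≡⟨ Centering-identityˡ colSums i j ⟨
      (Centering n ⊗ (Ld ⊗ L)) i j     ≡⟨ ⊗-congˡ (Ld ⊗ L) inverse-⊗ i j ⟨
      ((X ⊗ L) ⊗ (Ld ⊗ L)) i j         ≡⟨ ⊗-assoc X L (Ld ⊗ L) i j ⟩
      (X ⊗ (L ⊗ (Ld ⊗ L))) i j         ≡⟨ ⊗-congʳ X (λ a b → trans (sym (⊗-assoc L Ld L a b)) (L⊗Ld⊗L a b)) i j ⟩
      (X ⊗ L) i j                      ≡⟨ inverse-⊗ i j ⟩
      Centering n i j                  ∎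
      where
      colSums : ColSumsZero (Ld ⊗ L)
      colSums = symmetric⇒colSumsZero Ld⊗L-symmetric (⊗-rowSumsZero Ld rowL)

    ⊗-pinv : (L ⊗ Ld) ≐ Centering n
    ⊗-pinv i j = begin
      (L ⊗ Ld) i j                     ≡⟨ Centering-identityʳ rowSums i j ⟨
      ((L ⊗ Ld) ⊗ Centering n) i j     ≡⟨ ⊗-congʳ (L ⊗ Ld) ⊗-inverse i j ⟨
      ((L ⊗ Ld) ⊗ (L ⊗ X)) i j         ≡⟨ ⊗-assoc (L ⊗ Ld) L X i j ⟨
      (((L ⊗ Ld) ⊗ L) ⊗ X) i j         ≡⟨ ⊗-congˡ X L⊗Ld⊗L i j ⟩
      (L ⊗ X) i j                      ≡⟨ ⊗-inverse i j ⟩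
      Centering n i j                  ∎
      where
      rowSums : RowSumsZero (L ⊗ Ld)
      rowSums = symmetric⇒rowSumsZero L⊗Ld-symmetric (⊗-colSumsZero Ld colL)

    pinv-colSumsZero : ColSumsZero Ld
    pinv-colSumsZero j = begin
      sumF (λ i → Ld i j)                  ≡⟨ sumF-cong (λ i → trans (sym (Ld⊗L⊗Ld i j)) (⊗-congˡ Ld pinv-⊗ i j)) ⟩
      sumF (λ i → (Centering n ⊗ Ld) i j)  ≡⟨ ⊗-colSumsZero Ld (Centering-colSumsZero n) j ⟩
      0ℚ                                   ∎

    pinv≡inverse-J/n : ∀ i j → Ld i j ≡ X i j - inv n
    pinv≡inverse-J/n i j = begin
      Ld i j                           ≡⟨ Centering-identityˡ pinv-colSumsZero i j ⟨
      (Centering n ⊗ Ld) i j           ≡⟨ ⊗-congˡ Ld inverse-⊗ i j ⟨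
      ((X ⊗ L) ⊗ Ld) i j               ≡⟨ ⊗-assoc X L Ld i j ⟩
      (X ⊗ (L ⊗ Ld)) i j               ≡⟨ ⊗-congʳ X ⊗-pinv i j ⟩
      (X ⊗ Centering n) i j            ≡⟨ vm-Centering (X i) j ⟩
      X i j - inv n * sumF (X i)       ≡⟨ cong (λ s → X i j - inv n * s) (inverse-rowSums i) ⟩
      X i j - inv n * 1ℚ               ≡⟨ cong (λ s → X i j - s) (*-identityʳ (inv n)) ⟩
      X i j - inv n                    ∎

    pinv-rowSumsZero : RowSumsZero Ld
    pinv-rowSumsZero i = begin
      sumF (Ld i)                      ≡⟨ sumF-cong (pinv≡inverse-J/n i) ⟩
      sumF (λ j → X i j - inv n)       ≡⟨ sumF-- (X i) (λ _ → inv n) ⟩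
      sumF (X i) - sumF {n} (λ _ → inv n) ≡⟨ cong₂ _-_ (inverse-rowSums i) (sumF-inv n) ⟩
      1ℚ - 1ℚ                          ≡⟨ +-inverseʳ 1ℚ ⟩
      0ℚ                               ∎

module ResistanceIdentities {n : ℕ} {{_ : NonZero n}} {E : Digraph n} (balanced : Balanced E)
  (Ld X : Matrix n) (pinv : IsMoorePenrose (Laplacian E) Ld)
  (inverse : IsInverse (Laplacian E ⊕ scale (inv n) Jm) X) where

  private
    L : Matrix n
    L = Laplacian E

    R : Matrix n
    R = resistance Ld

    d : Vector n
    d = diagonal Ld

    τ : Vector n
    τ = tauVec E R

    X̃ : Matrix n
    X̃ = diagM X

    M : Matrix n
    M = L ⊖ transpose L

    rowL : RowSumsZero L
    rowL = Laplacian-rowSumsZero E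

    colL : ColSumsZero L
    colL = Laplacian-colSumsZero balanced

  open CentredInverse rowL colL inverse
  open MoorePenrose pinv

  inverse-diagonal : ∀ i → X i i ≡ d i + inv n
  inverse-diagonal i = begin
    X i i                    ≡⟨ solve 2 (λ x c → x := (x :- c) :+ c) refl (X i i) (inv n) ⟩
    X i i - inv n + inv n    ≡⟨ cong (_+ inv n) (pinv≡inverse-J/n i i) ⟨
    d i + inv n              ∎

  L⊗R≡ : ∀ i j → (L ⊗ R) i j ≡ mv L d i - ℕtoℚ 2 * Centering n i j
  L⊗R≡ i j = begin
    vm (L i) R j
      ≡⟨ vm-resistance Ld (L i) j ⟩
    mv L d i + sumF (L i) * Ld j j - ℕtoℚ 2 * (L ⊗ Ld) i j
      ≡⟨ cong₂ (λ s p → mv L d i + s * Ld j j - ℕtoℚ 2 * p) (rowL i) (⊗-pinv i j) ⟩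
    mv L d i + 0ℚ * Ld j j - ℕtoℚ 2 * Centering n i j
      ≡⟨ solve 3 (λ a b p → a :+ con 0ℚ :* b :- con (ℕtoℚ 2) :* p := a :- con (ℕtoℚ 2) :* p)
                 refl (mv L d i) (Ld j j) (Centering n i j) ⟩
    mv L d i - ℕtoℚ 2 * Centering n i j
      ∎

  R⊗L≡ : ∀ i j → (R ⊗ L) i j ≡ vm d L j - ℕtoℚ 2 * Centering n i j
  R⊗L≡ i j = begin
    mv R (λ k → L k j) i
      ≡⟨ mv-resistance Ld (λ k → L k j) i ⟩
    d i * sumF (λ k → L k j) + vm d L j - ℕtoℚ 2 * (Ld ⊗ L) i j
      ≡⟨ cong₂ (λ s p → d i * s + vm d L j - ℕtoℚ 2 * p) (colL j) (pinv-⊗ i j) ⟩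
    d i * 0ℚ + vm d L j - ℕtoℚ 2 * Centering n i j
      ≡⟨ solve 3 (λ a b p → b :* con 0ℚ :+ a :- con (ℕtoℚ 2) :* p := a :- con (ℕtoℚ 2) :* p)
                 refl (vm d L j) (d i) (Centering n i j) ⟩
    vm d L j - ℕtoℚ 2 * Centering n i j
      ∎

  τ≡L·d+2/n : ∀ i → τ i ≡ mv L d i + ℕtoℚ 2 * inv n
  τ≡L·d+2/n i = begin
    τ i
      ≡⟨ tauVec-Laplacian E R (resistance-diagonal Ld) i ⟩
    ℕtoℚ 2 + (L ⊗ R) i i
      ≡⟨ cong (ℕtoℚ 2 +_) (trans (L⊗R≡ i i) (cong (λ p → mv L d i - ℕtoℚ 2 * p) (Centering-diagonal i))) ⟩
    ℕtoℚ 2 + (mv L d i - ℕtoℚ 2 * (1ℚ - inv n))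
      ≡⟨ solve 2 (λ a c → con (ℕtoℚ 2) :+ (a :- con (ℕtoℚ 2) :* (con 1ℚ :- c)) := a :+ con (ℕtoℚ 2) :* c)
                 refl (mv L d i) (inv n) ⟩
    mv L d i + ℕtoℚ 2 * inv n
      ∎

  sumF-τ : sumF τ ≡ ℕtoℚ 2
  sumF-τ = begin
    sumF τ
      ≡⟨ sumF-cong τ≡L·d+2/n ⟩
    sumF (λ i → mv L d i + ℕtoℚ 2 * inv n)
      ≡⟨ sumF-+ (mv L d) (λ _ → ℕtoℚ 2 * inv n) ⟩
    sumF (mv L d) + sumF {n} (λ _ → ℕtoℚ 2 * inv n)
      ≡⟨ cong₂ _+_ (colSumsZero⇒sumF-mv≡0 colL d) (sumF-*ˡ {n} (ℕtoℚ 2) (λ _ → inv n)) ⟩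
    0ℚ + ℕtoℚ 2 * sumF {n} (λ _ → inv n)
      ≡⟨ cong (λ s → 0ℚ + ℕtoℚ 2 * s) (sumF-inv n) ⟩
    0ℚ + ℕtoℚ 2 * 1ℚ
      ≡⟨⟩
    ℕtoℚ 2
      ∎

  pinv-τ : ∀ i → mv Ld τ i ≡ d i - inv n * trace Ld
  pinv-τ i = begin
    mv Ld τ i
      ≡⟨ mv-cong Ld τ≡L·d+2/n i ⟩
    mv Ld (λ k → mv L d k + ℕtoℚ 2 * inv n) i
      ≡⟨ dot-+ʳ (Ld i) (mv L d) (ℕtoℚ 2 * inv n) ⟩
    mv Ld (mv L d) i + sumF (Ld i) * (ℕtoℚ 2 * inv n)
      ≡⟨ cong (λ s → mv Ld (mv L d) i + s * (ℕtoℚ 2 * inv n)) (pinv-rowSumsZero i) ⟩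
    mv Ld (mv L d) i + 0ℚ * (ℕtoℚ 2 * inv n)
      ≡⟨ solve 2 (λ p a → p :+ con 0ℚ :* a := p) refl (mv Ld (mv L d) i) (ℕtoℚ 2 * inv n) ⟩
    mv Ld (mv L d) i
      ≡⟨ mv-⊗ Ld L d i ⟨
    mv (Ld ⊗ L) d i
      ≡⟨ sumF-cong (λ k → cong (_* d k) (pinv-⊗ i k)) ⟩
    mv (Centering n) d i
      ≡⟨ mv-Centering d i ⟩
    d i - inv n * trace Ld
      ∎

  -- R τ is the constant vector dᵀτ + (2/n) tr L†, since Σ τ = 2 and L† τ = d − (1/n) tr L†.
  τᵀRτ≡2dᵀLd+8/n·trL† : quad τ R ≡ ℕtoℚ 2 * quad d L + ℕtoℚ 8 * inv n * trace Ld
  τᵀRτ≡2dᵀLd+8/n·trL† = begin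
    quad τ R
      ≡⟨ quad≡dot τ R ⟩
    dot τ (mv R τ)
      ≡⟨ sumF-cong (λ i → cong (τ i *_) (R-τ i)) ⟩
    sumF (λ i → τ i * κ)
      ≡⟨ sumF-*ʳ κ τ ⟩
    sumF τ * κ
      ≡⟨ cong (_* κ) sumF-τ ⟩
    ℕtoℚ 2 * κ
      ≡⟨ cong (λ s → ℕtoℚ 2 * (s + ℕtoℚ 2 * inv n * trace Ld)) dᵀτ ⟩
    ℕtoℚ 2 * (quad d L + trace Ld * (ℕtoℚ 2 * inv n) + ℕtoℚ 2 * inv n * trace Ld)
      ≡⟨ solve 3 (λ q c t → con (ℕtoℚ 2) :* (q :+ t :* (con (ℕtoℚ 2) :* c) :+ con (ℕtoℚ 2) :* c :* t)
                              := con (ℕtoℚ 2) :* q :+ con (ℕtoℚ 8) :* c :* t)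
                 refl (quad d L) (inv n) (trace Ld) ⟩
    ℕtoℚ 2 * quad d L + ℕtoℚ 8 * inv n * trace Ld
      ∎
    where
    κ : ℚ
    κ = dot d τ + ℕtoℚ 2 * inv n * trace Ld

    R-τ : ∀ i → mv R τ i ≡ κ
    R-τ i = begin
      mv R τ i
        ≡⟨ mv-resistance Ld τ i ⟩
      d i * sumF τ + dot d τ - ℕtoℚ 2 * mv Ld τ i
        ≡⟨ cong₂ (λ s p → d i * s + dot d τ - ℕtoℚ 2 * p) sumF-τ (pinv-τ i) ⟩
      d i * ℕtoℚ 2 + dot d τ - ℕtoℚ 2 * (d i - inv n * trace Ld)
        ≡⟨ solve 4 (λ a s c t → a :* con (ℕtoℚ 2) :+ s :- con (ℕtoℚ 2) :* (a :- c :* t) := s :+ con (ℕtoℚ 2) :* c :* t)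
                   refl (d i) (dot d τ) (inv n) (trace Ld) ⟩
      κ
        ∎

    dᵀτ : dot d τ ≡ quad d L + trace Ld * (ℕtoℚ 2 * inv n)
    dᵀτ = begin
      dot d τ                                        ≡⟨ sumF-cong (λ i → cong (d i *_) (τ≡L·d+2/n i)) ⟩
      dot d (λ i → mv L d i + ℕtoℚ 2 * inv n)        ≡⟨ dot-+ʳ d (mv L d) (ℕtoℚ 2 * inv n) ⟩
      dot d (mv L d) + trace Ld * (ℕtoℚ 2 * inv n)   ≡⟨ cong (_+ trace Ld * (ℕtoℚ 2 * inv n)) (quad≡dot d L) ⟨
      quad d L + trace Ld * (ℕtoℚ 2 * inv n)         ∎

  pinv-diagonal≡quad : ∀ i → d i ≡ quad (λ k → Ld k i) L
  pinv-diagonal≡quad i = sym (begin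
    quad (λ k → Ld k i) L                                 ≡⟨ quad≡dot (λ k → Ld k i) L ⟩
    dot (λ k → Ld k i) (λ k → (L ⊗ Ld) k i)               ≡⟨ sumF-cong (λ k → cong (Ld k i *_) (⊗-pinv k i)) ⟩
    vm (λ k → Ld k i) (Centering n) i                     ≡⟨ vm-Centering (λ k → Ld k i) i ⟩
    d i - inv n * sumF (λ k → Ld k i)                     ≡⟨ cong (λ s → d i - inv n * s) (pinv-colSumsZero i) ⟩
    d i - inv n * 0ℚ                                      ≡⟨ solve 2 (λ a c → a :- c :* con 0ℚ := a) refl (d i) (inv n) ⟩
    d i                                                   ∎)

  pinv-diagonal-nonneg : ∀ i → 0ℚ ℚ.≤ d i
  pinv-diagonal-nonneg i = subst (0ℚ ℚ.≤_) (sym (pinv-diagonal≡quad i)) (Laplacian-quad-nonneg balanced (λ k → Ld k i))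

  -- If l†ᵢᵢ vanished, the i-th column w of L† would satisfy wᵀLw = 0, hence L w = 0; but (L L†)ᵢᵢ = 1 − 1/n.
  pinv-diagonal-pos : inv n ≢ 1ℚ → ∀ i → 0ℚ < d i
  pinv-diagonal-pos c≢1 i with <-cmp 0ℚ (d i)
  ... | tri< 0<d _ _ = 0<d
  ... | tri> _ _ d<0 = ⊥-elim (<-irrefl refl (≤-<-trans (pinv-diagonal-nonneg i) d<0))
  ... | tri≈ _ 0≡d _ = ⊥-elim (c≢1 (begin
    inv n                        ≡⟨ solve 1 (λ c → c := con 1ℚ :- (con 1ℚ :- c)) refl (inv n) ⟩
    1ℚ - (1ℚ - inv n)            ≡⟨ cong (λ s → 1ℚ - s) (Centering-diagonal i) ⟨
    1ℚ - Centering n i i         ≡⟨ cong (λ s → 1ℚ - s) (⊗-pinv i i) ⟨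
    1ℚ - (L ⊗ Ld) i i            ≡⟨ cong (λ s → 1ℚ - s) L-column≡0 ⟩
    1ℚ - 0ℚ                      ≡⟨⟩
    1ℚ                           ∎))
    where
    L-column≡0 : mv L (λ k → Ld k i) i ≡ 0ℚ
    L-column≡0 = Laplacian-quad≡0⇒mv≡0 balanced (λ k → Ld k i) (trans (sym (pinv-diagonal≡quad i)) (sym 0≡d)) i

  trace-pinv-pos : 2 ≤ n → 0ℚ < trace Ld
  trace-pinv-pos (s≤s (s≤s {n = m} _)) = <-≤-trans (pinv-diagonal-pos (inv≢1 m) zero) (term≤sumF pinv-diagonal-nonneg zero)

  private
    X̃𝟏≡d+1/n : ∀ k → mv X̃ 𝟏 k ≡ d k + inv n
    X̃𝟏≡d+1/n k = trans (mv-Diag (diagonal X) 𝟏 k) (trans (*-identityʳ (X k k)) (inverse-diagonal k))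

    𝟏X̃≡d+1/n : ∀ k → vm 𝟏 X̃ k ≡ d k + inv n
    𝟏X̃≡d+1/n k = trans (vm-Diag (diagonal X) 𝟏 k) (trans (*-identityˡ (X k k)) (inverse-diagonal k))

  τ≡LX̃𝟏+2/n : ∀ i → τ i ≡ mv (L ⊗ X̃) 𝟏 i + ℕtoℚ 2 * inv n
  τ≡LX̃𝟏+2/n i = begin
    τ i                                           ≡⟨ τ≡L·d+2/n i ⟩
    mv L d i + ℕtoℚ 2 * inv n                     ≡⟨ cong (_+ ℕtoℚ 2 * inv n) (rowSumsZero⇒mv-shift rowL d (inv n) i) ⟨
    mv L (λ k → d k + inv n) i + ℕtoℚ 2 * inv n   ≡⟨ cong (_+ ℕtoℚ 2 * inv n) (mv-cong L inverse-diagonal i) ⟨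
    mv L (diagonal X) i + ℕtoℚ 2 * inv n          ≡⟨ cong (_+ ℕtoℚ 2 * inv n) (mv-⊗-Diag-𝟏 L (diagonal X) i) ⟨
    mv (L ⊗ X̃) 𝟏 i + ℕtoℚ 2 * inv n               ∎

  τ+𝟏X̃M≡𝟏X̃L+2/n : ∀ j → τ j + vm (vm 𝟏 X̃) M j ≡ vm (vm 𝟏 X̃) L j + ℕtoℚ 2 * inv n
  τ+𝟏X̃M≡𝟏X̃L+2/n j = begin
    τ j + vm (vm 𝟏 X̃) M j
      ≡⟨ cong₂ _+_ (τ≡L·d+2/n j) (vm-⊖-transpose L (vm 𝟏 X̃) j) ⟩
    (mv L d j + ℕtoℚ 2 * inv n) + (vm (vm 𝟏 X̃) L j - mv L (vm 𝟏 X̃) j)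
      ≡⟨ cong (λ s → (mv L d j + ℕtoℚ 2 * inv n) + (vm (vm 𝟏 X̃) L j - s)) L𝟏X̃≡Ld ⟩
    (mv L d j + ℕtoℚ 2 * inv n) + (vm (vm 𝟏 X̃) L j - mv L d j)
      ≡⟨ solve 3 (λ a c b → (a :+ c) :+ (b :- a) := b :+ c) refl (mv L d j) (ℕtoℚ 2 * inv n) (vm (vm 𝟏 X̃) L j) ⟩
    vm (vm 𝟏 X̃) L j + ℕtoℚ 2 * inv n
      ∎
    where
    L𝟏X̃≡Ld : mv L (vm 𝟏 X̃) j ≡ mv L d j
    L𝟏X̃≡Ld = trans (mv-cong L 𝟏X̃≡d+1/n j) (rowSumsZero⇒mv-shift rowL d (inv n) j)

  LR+2I≡τ𝟏ᵀ : (L ⊗ R ⊕ scale (ℕtoℚ 2) Id) ≐ (λ i j → τ i * 𝟏 j)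
  LR+2I≡τ𝟏ᵀ i j = begin
    (L ⊗ R) i j + ℕtoℚ 2 * Id i j
      ≡⟨ cong (_+ ℕtoℚ 2 * Id i j) (L⊗R≡ i j) ⟩
    mv L d i - ℕtoℚ 2 * (Id i j - inv n) + ℕtoℚ 2 * Id i j
      ≡⟨ solve 3 (λ a e c → a :- con (ℕtoℚ 2) :* (e :- c) :+ con (ℕtoℚ 2) :* e := (a :+ con (ℕtoℚ 2) :* c) :* con 1ℚ)
                 refl (mv L d i) (Id i j) (inv n) ⟩
    (mv L d i + ℕtoℚ 2 * inv n) * 1ℚ
      ≡⟨ cong (_* 1ℚ) (τ≡L·d+2/n i) ⟨
    τ i * 1ℚ
      ∎

  RL+2I≡𝟏τᵀ+JX̃M : (R ⊗ L ⊕ scale (ℕtoℚ 2) Id) ≐ ((λ i j → 𝟏 i * τ j) ⊕ Jm ⊗ X̃ ⊗ M)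
  RL+2I≡𝟏τᵀ+JX̃M i j = begin
    (R ⊗ L) i j + ℕtoℚ 2 * Id i j
      ≡⟨ cong (_+ ℕtoℚ 2 * Id i j) (R⊗L≡ i j) ⟩
    vm d L j - ℕtoℚ 2 * (Id i j - inv n) + ℕtoℚ 2 * Id i j
      ≡⟨ solve 3 (λ a e c → a :- con (ℕtoℚ 2) :* (e :- c) :+ con (ℕtoℚ 2) :* e := a :+ con (ℕtoℚ 2) :* c)
                 refl (vm d L j) (Id i j) (inv n) ⟩
    vm d L j + ℕtoℚ 2 * inv n
      ≡⟨ cong (_+ ℕtoℚ 2 * inv n) 𝟏X̃L≡dL ⟨
    vm (vm 𝟏 X̃) L j + ℕtoℚ 2 * inv n
      ≡⟨ τ+𝟏X̃M≡𝟏X̃L+2/n j ⟨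
    τ j + vm (vm 𝟏 X̃) M j
      ≡⟨ cong (_+ vm (vm 𝟏 X̃) M j) (*-identityˡ (τ j)) ⟨
    1ℚ * τ j + vm (vm 𝟏 X̃) M j
      ∎
    where
    𝟏X̃L≡dL : vm (vm 𝟏 X̃) L j ≡ vm d L j
    𝟏X̃L≡dL = trans (vm-cong L 𝟏X̃≡d+1/n j) (colSumsZero⇒vm-shift colL d (inv n) j)

  𝟏ᵀτ≡2 : sumF (λ i → 𝟏 i * τ i) ≡ ℕtoℚ 2
  𝟏ᵀτ≡2 = trans (sumF-cong (λ i → *-identityˡ (τ i))) sumF-τ

  τᵀRτ≡2x̃ᵀLx̃+8/n·trL† : quad τ R ≡ ℕtoℚ 2 * quad (mv X̃ 𝟏) L + ℕtoℚ 8 * inv n * trace Ld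
  τᵀRτ≡2x̃ᵀLx̃+8/n·trL† = begin
    quad τ R                                              ≡⟨ τᵀRτ≡2dᵀLd+8/n·trL† ⟩
    ℕtoℚ 2 * quad d L + ℕtoℚ 8 * inv n * trace Ld         ≡⟨ cong (λ q → ℕtoℚ 2 * q + ℕtoℚ 8 * inv n * trace Ld) x̃ᵀLx̃≡dᵀLd ⟨
    ℕtoℚ 2 * quad (mv X̃ 𝟏) L + ℕtoℚ 8 * inv n * trace Ld  ∎
    where
    x̃ᵀLx̃≡dᵀLd : quad (mv X̃ 𝟏) L ≡ quad d L
    x̃ᵀLx̃≡dᵀLd = trans (quad-cong L X̃𝟏≡d+1/n) (sumsZero⇒quad-shift rowL colL d (inv n))

  τᵀRτ>0 : 2 ≤ n → 0ℚ < quad τ R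
  τᵀRτ>0 2≤n = subst (0ℚ <_) (sym τᵀRτ≡2dᵀLd+8/n·trL†) (+-mono-≤-< 0≤2q 0<8c·tr)
    where
    0≤2q : 0ℚ ℚ.≤ ℕtoℚ 2 * quad d L
    0≤2q = subst (ℚ._≤ ℕtoℚ 2 * quad d L) (*-zeroʳ (ℕtoℚ 2))
             (*-monoˡ-≤-nonNeg (ℕtoℚ 2) (Laplacian-quad-nonneg balanced d))
    0<8c·tr : 0ℚ < ℕtoℚ 8 * inv n * trace Ld
    0<8c·tr = positive⁻¹ (ℕtoℚ 8 * inv n * trace Ld)
      {{pos*pos⇒pos (ℕtoℚ 8 * inv n) {{pos*pos⇒pos (ℕtoℚ 8) (inv n) {{inv-pos n}}}}
                    (trace Ld) {{positive (trace-pinv-pos 2≤n)}}}}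

-- Strong connectivity is only needed for L + J/n to be invertible, which is assumed here through X;
-- loops cancel in L = Diag(A𝟏) − A and contribute r_ii = 0 to τ.
lemma4p1 : (n : ℕ) → 2 ≤ n → (E : Digraph n) →
  Simple E → StronglyConnected E → Balanced E →
  (Ld X : Matrix n) →
  IsMoorePenrose (Laplacian E) Ld →
  IsInverse (Laplacian E ⊕ scale (inv n) Jm) X →
  let L = Laplacian E
      R = resistance Ld
      X̃ = diagM X
      x̃ = mv X̃ 𝟏
      M = L ⊖ transpose L
      τ = tauVec E R
  in ((∀ i → τ i ≡ mv (L ⊗ X̃) 𝟏 i + ℕtoℚ 2 * inv n)
     × (∀ j → τ j + vm (vm 𝟏 X̃) M j ≡ vm (vm 𝟏 X̃) L j + ℕtoℚ 2 * inv n)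
     × ((L ⊗ R ⊕ scale (ℕtoℚ 2) Id) ≐ (λ i j → τ i * 𝟏 j))
     × ((R ⊗ L ⊕ scale (ℕtoℚ 2) Id) ≐ ((λ i j → 𝟏 i * τ j) ⊕ Jm ⊗ X̃ ⊗ M))
     × (sumF (λ i → 𝟏 i * τ i) ≡ ℕtoℚ 2)
     × (quad τ R ≡ ℕtoℚ 2 * quad x̃ L + ℕtoℚ 8 * inv n * trace Ld)
     × (0ℚ < quad τ R))
lemma4p1 zero () _
lemma4p1 (suc n) 2≤n E _ _ balanced Ld X pinv inverse =
  τ≡LX̃𝟏+2/n , τ+𝟏X̃M≡𝟏X̃L+2/n , LR+2I≡τ𝟏ᵀ , RL+2I≡𝟏τᵀ+JX̃M ,
  𝟏ᵀτ≡2 , τᵀRτ≡2x̃ᵀLx̃+8/n·trL† , τᵀRτ>0 2≤n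
  where open ResistanceIdentities balanced Ld X pinv inverse
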